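{- For every $N \in \mathbb{N} \cup \{\mathbb{N}\}$, the class of partial bp-automorphisms of $\mathbb{U}^\prec_N$ has strong JEP: for any partial bp-automorphisms $q_0,q_1$ there exist a partial bp-automorphism $r$ and embeddings $\phi_i$ of $q_i$ into $r$ ($i=0,1$) with $\phi_0[\mathrm{zdef}(q_0)]\cap\phi_1[\mathrm{zdef}(q_1)]=\emptyset$.
   Context: An ultrametric space is a metric space $(X,d)$ with $d(x,z)\le\max(d(x,y),d(y,z))$. A ball is a set $B_r(x)=\{y:d(x,y)<r\}$, $r>0$. A linear order $\prec$ on $X$ is convex if $x\prec y\prec z$ implies $d(x,y)\le d(x,z)$. An $r$-polygon is a set $P$ with $d(x,y)=r$ for all distinct $x,y\in P$. For $N\in\mathbb{N}\cup\{\mathbb{N}\}$, $\mathcal{K}^\prec_N$ is the class of finite ultrametric spaces with rational distances and a convex linear order, in which every $r$-polygon has size at most $N$ (for $N=\mathbb{N}$ no bound), in the language of binary relations $d_q$ ($q\in\mathbb{Q}$) and $\prec$; $\mathbb{U}^\prec_N$ is its Fraïssé limit. A bp-bijection between ordered ultrametric spaces is an order-preserving bijection $\Phi$ such that $\Phi$ and $\Phi^{ -1}$ map balls onto balls. A partial bp-automorphism of $X$ is a bp-bijection $p:A\to B$ between finite subsets of $X$; for $X=\mathbb{U}^\prec_N$ each extends to a bp-bijection $X\to X$. For a map $f$, $\mathrm{zdef}(f)=\mathrm{dom}(f)\cup\mathrm{rng}(f)$. An embedding of a partial bp-automorphism $p$ into $q$ is a partial bp-automorphism $\phi$ with $\mathrm{zdef}(p)\subseteq\mathrm{dom}(\phi)$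 and $\phi(p(x))=q(\phi(x))$ for all $x\in\mathrm{dom}(p)$. -}

module Defs where

open import Level using (0ℓ)
open import Data.Nat using (ℕ; suc)
import Data.Nat as ℕ
open import Data.Fin using (Fin)
open import Data.Maybe using (Maybe; just; nothing)
open import Data.Rational using (ℚ; 0ℚ; _<_; _≤_; _⊔_)
open import Data.Product using (Σ; ∃; ∃-syntax; _×_; _,_; proj₁; proj₂)
open import Data.List using (List; length; map; _++_)
open import Data.List.Membership.Propositional using (_∈_)
open import Data.List.Relation.Unary.AllPairs using (AllPairs)
open import Data.Unit using (⊤)
open import Relation.Nullary using (¬_)
open import Relation.Binary.PropositionalEquality using (_≡_; _≢_)
open import Relation.Binary.Structures using (IsStrictTotalOrder)
open import Function.Bundles using (_⇔_)

record OrdUltrametric : Set₁ where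
  field
    Carrier    : Set
    d          : Carrier → Carrier → ℚ
    _≺_        : Carrier → Carrier → Set
    d-nonneg   : ∀ x y → 0ℚ ≤ d x y
    d-zero⇒≡   : ∀ x y → d x y ≡ 0ℚ → x ≡ y
    d-refl     : ∀ x → d x x ≡ 0ℚ
    d-sym      : ∀ x y → d x y ≡ d y x
    d-ultra    : ∀ x y z → d x z ≤ (d x y ⊔ d y z)
    ≺-sto      : IsStrictTotalOrder _≡_ _≺_
    convex     : ∀ x y z → x ≺ y → y ≺ z → d x y ≤ d x z

open OrdUltrametric public

-- N ∈ ℕ ∪ {ℕ}:  just n  is a finite bound n,  nothing  means no bound.
Bound : Set
Bound = Maybe ℕ

_≤ᴮ_ : ℕ → Bound → Set
k ≤ᴮ just n  = k ℕ.≤ n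
k ≤ᴮ nothing = ⊤

IsPolygon : (X : OrdUltrametric) → ℚ → List (Carrier X) → Set
IsPolygon X r P = AllPairs (λ x y → x ≢ y × d X x y ≡ r) P

PolygonBounded : Bound → OrdUltrametric → Set
PolygonBounded N X = ∀ (r : ℚ) (P : List (Carrier X)) → IsPolygon X r P → length P ≤ᴮ N

record Embedding (A B : OrdUltrametric) : Set where
  field
    emb       : Carrier A → Carrier B
    injective : ∀ x y → emb x ≡ emb y → x ≡ y
    pres-d    : ∀ x y → d B (emb x) (emb y) ≡ d A x y
    pres-≺    : ∀ x y → (_≺_ A x y ⇔ _≺_ B (emb x) (emb y))

open Embedding public

IsFinite : OrdUltrametric → Set
IsFinite A = Σ ℕ λ n → Σ (Fin n → Carrier A) λ e → ∀ a → ∃[ i ] e i ≡ a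

-- membership in the class K^≺_N (rational distances are built in)
InK : Bound → OrdUltrametric → Set
InK N A = IsFinite A × PolygonBounded N A

Countable : Set → Set
Countable C = Σ (ℕ → C) λ e → ∀ c → ∃[ n ] e n ≡ c

-- X is (isomorphic to) the Fraïssé limit U^≺_N of K^≺_N:
-- X is countable, its age is contained in K^≺_N (every finite subset obeys the
-- polygon bound), and X is K^≺_N-rich (extension property).  By Fraïssé's
-- theorem these characterise the Fraïssé limit up to isomorphism.
IsFraisseLimit : Bound → OrdUltrametric → Set₁
IsFraisseLimit N X =
  Countable (Carrier X) ×
  PolygonBounded N X ×
  (∀ (A B : OrdUltrametric) → InK N A → InK N B →
     (e : Embedding A B) (f : Embedding A X) →
     Σ (Embedding B X) λ g → ∀ a → emb g (emb e a) ≡ emb f a)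

module _ (X : OrdUltrametric) where

  private
    C = Carrier X

  PMap : Set
  PMap = List (C × C)

  dom : PMap → List C
  dom p = map proj₁ p

  rng : PMap → List C
  rng p = map proj₂ p

  zdef : PMap → List C
  zdef p = dom p ++ rng p

  record IsPartialBpAut (p : PMap) : Set where
    field
      functional : ∀ x y y' → (x , y) ∈ p → (x , y') ∈ p → y ≡ y'
      injective  : ∀ x x' y → (x , y) ∈ p → (x' , y) ∈ p → x ≡ x'
      monotone   : ∀ x y x' y' → (x , y) ∈ p → (x' , y') ∈ p →
                   _≺_ X x x' → _≺_ X y y'
      balls→     : ∀ x → x ∈ dom p → ∀ r → 0ℚ < r →
                   Σ C λ y → y ∈ rng p × Σ ℚ λ s → 0ℚ < s ×
                   (∀ b → ((b ∈ rng p × d X y b < s) ⇔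
                           (∃[ a ] ((a , b) ∈ p × d X x a < r))))
      balls←     : ∀ y → y ∈ rng p → ∀ r → 0ℚ < r →
                   Σ C λ x → x ∈ dom p × Σ ℚ λ s → 0ℚ < s ×
                   (∀ a → ((a ∈ dom p × d X x a < s) ⇔
                           (∃[ b ] ((a , b) ∈ p × d X y b < r))))

  record IsEmbeddingInto (φ p q : PMap) : Set where
    field
      φ-bp    : IsPartialBpAut φ
      covers  : ∀ x → x ∈ zdef p → x ∈ dom φ
      commute : ∀ x y u v → (x , y) ∈ p → (x , u) ∈ φ → (y , v) ∈ φ → (u , v) ∈ q

  InImage : PMap → List C → C → Set
  InImage φ S v = ∃[ x ] (x ∈ S × (x , v) ∈ φ)

ValidBound : Bound → Set
ValidBound (just n) = 2 ℕ.≤ n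
ValidBound nothing  = ⊤

module Submission where

-- Idea: leave q₀ where it is and move a copy of q₁ far to the right of it.  Let
-- L₀ = zdef q₀, L₁ = zdef q₁ and let D exceed every distance inside L₀ ++ L₁.  The ordered
-- sum L₀ ⊕_D L₁ (L₀ before L₁, distance D across) lies in K^≺_N, because N ≥ 2 bounds its
-- D-polygons, which have at most one point on each side.  Richness of X extends the
-- inclusion of L₀ to this sum; on L₁ it is a "far copy" ψ: an order-preserving isometry
-- whose image lies after L₀ at distance exactly D from it.  Then r = q₀ ∪ ψ q₁ ψ⁻¹ is a
-- partial bp-automorphism: a ball of radius ≤ D around a point of its domain lies in one
-- of the two parts, where q₀ resp. the copy of q₁ maps it onto a ball, while a ball of
-- radius > D is the whole domain.  The embeddings are the identity on L₀ and ψ on L₁,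
-- with disjoint images L₀ and ψ[L₁].

open import Defs
import Data.Nat as ℕ
import Data.Nat.Properties as ℕP
open import Data.Rational using (ℚ; 0ℚ; 1ℚ; _<_; _≤_; _⊔_; _⊓_; _+_)
import Data.Rational.Properties as ℚP
open import Data.Product using (Σ; ∃; ∃-syntax; _×_; _,_; proj₁; proj₂; swap)
open import Data.Sum using (_⊎_; inj₁; inj₂)
open import Data.Sum.Properties using (inj₁-injective; inj₂-injective)
open import Data.List using (List; []; _∷_; length; map; _++_; lookup; tabulate; cartesianProductWith)
open import Data.List.Properties using (length-map)
open import Data.List.Membership.Propositional using (_∈_; mapWith∈)
open import Data.List.Membership.Propositional.Properties
  using (∈-tabulate⁺; ∈-map⁺; ∈-map⁻; ∈-++⁺ˡ; ∈-++⁺ʳ; ∈-++⁻; ∈-cartesianProductWith⁺)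
import Data.List.Membership.DecPropositional as DecMembership
open import Data.List.Relation.Unary.Any using (here; there; index)
open import Data.List.Relation.Unary.Any.Properties using (lookup-index)
open import Data.List.Relation.Unary.All as All using (All; []; _∷_)
open import Data.List.Relation.Unary.AllPairs as AllPairs using (AllPairs; []; _∷_)
import Data.List.Relation.Unary.AllPairs.Properties as AllPairsP
open import Relation.Binary.Bundles using (DecTotalOrder)
import Data.List.Extrema (DecTotalOrder.totalOrder ℚP.≤-decTotalOrder) as ℚExtrema
open import Data.Maybe using (just; nothing)
open import Data.Unit using (⊤; tt)
open import Data.Empty using (⊥; ⊥-elim)
open import Relation.Nullary using (¬_; yes; no)
open import Relation.Nullary.Decidable using (recompute)
open import Relation.Binary.PropositionalEquality
open import Relation.Binary.Structures using (IsStrictTotalOrder)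
open import Relation.Binary.Definitions using (Tri; tri<; tri≈; tri>)
open import Function using (id; _∘_; flip; case_of_)
open import Function.Bundles using (_⇔_; mk⇔; Equivalence)
open import Function.Construct.Identity using (⇔-id)
open import Function.Construct.Symmetry using (⇔-sym)

list⇒finite : (A : OrdUltrametric) (xs : List (Carrier A)) → (∀ a → a ∈ xs) → IsFinite A
list⇒finite A xs enumerates =
  length xs , lookup xs , λ a → index (enumerates a) , sym (lookup-index (enumerates a))

finite⇒list : (A : OrdUltrametric) → IsFinite A → Σ (List (Carrier A)) λ xs → ∀ a → a ∈ xs
finite⇒list A (_ , e , onto) = tabulate e , λ a → subst (_∈ tabulate e) (proj₂ (onto a)) (∈-tabulate⁺ (proj₁ (onto a)))

module Induced (X : OrdUltrametric) {T : Set} (f : T → Carrier X)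
               (f-injective : ∀ a b → f a ≡ f b → a ≡ b) where
  private
    module SX = IsStrictTotalOrder (≺-sto X)

  _≺ᵀ_ : T → T → Set
  a ≺ᵀ b = _≺_ X (f a) (f b)

  pulledBackOrder : IsStrictTotalOrder _≡_ _≺ᵀ_
  pulledBackOrder = record
    { isStrictPartialOrder = record
      { isEquivalence = isEquivalence
      ; irrefl        = λ a≡b → SX.irrefl (cong f a≡b)
      ; trans         = SX.trans
      ; <-resp-≈      = (λ { refl lt → lt }) , (λ { refl lt → lt }) }
    ; compare = compare }
    where
    compare : ∀ a b → Tri (a ≺ᵀ b) (a ≡ b) (b ≺ᵀ a)
    compare a b with SX.compare (f a) (f b)
    ... | tri< lt ¬eq ¬gt = tri< lt (¬eq ∘ cong f) ¬gt
    ... | tri≈ ¬lt eq ¬gt = tri≈ ¬lt (f-injective a b eq) ¬gt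
    ... | tri> ¬lt ¬eq gt = tri> ¬lt (¬eq ∘ cong f) gt

  Sub : OrdUltrametric
  Sub = record
    { Carrier  = T
    ; d        = λ a b → d X (f a) (f b)
    ; _≺_      = _≺ᵀ_
    ; d-nonneg = λ a b → d-nonneg X (f a) (f b)
    ; d-zero⇒≡ = λ a b e → f-injective a b (d-zero⇒≡ X (f a) (f b) e)
    ; d-refl   = λ a → d-refl X (f a)
    ; d-sym    = λ a b → d-sym X (f a) (f b)
    ; d-ultra  = λ a b c → d-ultra X (f a) (f b) (f c)
    ; ≺-sto    = pulledBackOrder
    ; convex   = λ a b c → convex X (f a) (f b) (f c) }

  inclusion : Embedding Sub X
  inclusion = record
    { emb = f ; injective = f-injective ; pres-d = λ _ _ → refl ; pres-≺ = λ _ _ → mk⇔ id id }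

  -- f maps an r-polygon of Sub onto an r-polygon of X of the same size.
  sub-polygonBounded : ∀ N → PolygonBounded N X → PolygonBounded N Sub
  sub-polygonBounded N bounded r P polygon =
    subst (_≤ᴮ N) (length-map f P) (bounded r (map f P) (AllPairsP.map⁺ (AllPairs.map image polygon)))
    where
    image : ∀ {a b} → a ≢ b × d X (f a) (f b) ≡ r → f a ≢ f b × d X (f a) (f b) ≡ r
    image (a≢b , dist) = (λ fa≡fb → a≢b (f-injective _ _ fa≡fb)) , dist

∈-mapWith∈ : ∀ {A B : Set} {K : List A} (f : ∀ {x} → x ∈ K → B) {x} (m : x ∈ K) → f m ∈ mapWith∈ K f
∈-mapWith∈ f (here refl) = here refl
∈-mapWith∈ f (there m)   = there (∈-mapWith∈ (f ∘ there) m)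

-- A point of X with an irrelevant proof that it occurs in L; points are equal
-- as soon as their underlying elements are.
record Member (X : OrdUltrametric) (L : List (Carrier X)) : Set where
  constructor _#_
  field
    elem : Carrier X
    .isIn : elem ∈ L

open Member public

module ListSubspace (X : OrdUltrametric) (L : List (Carrier X)) where
  open DecMembership (IsStrictTotalOrder._≟_ (≺-sto X)) using (_∈?_)

  elem-injective : ∀ (a b : Member X L) → elem a ≡ elem b → a ≡ b
  elem-injective (x # _) (.x # _) refl = refl

  open Induced X elem elem-injective public

  member-∈ : (a : Member X L) → elem a ∈ L
  member-∈ (x # m) = recompute (x ∈? L) m

  sub-finite : IsFinite Sub
  sub-finite = list⇒finite Sub (mapWith∈ L (λ {x} m → x # m)) (λ a → ∈-mapWith∈ _ (member-∈ a))

module OrderedSum (U V : OrdUltrametric) (D : ℚ) (D>0 : 0ℚ < D)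
                  (below-U : ∀ a b → d U a b < D) (below-V : ∀ a b → d V a b < D) where
  private
    module SU = IsStrictTotalOrder (≺-sto U)
    module SV = IsStrictTotalOrder (≺-sto V)
    P = Carrier U ⊎ Carrier V

  dist : P → P → ℚ
  dist (inj₁ a) (inj₁ b) = d U a b
  dist (inj₂ a) (inj₂ b) = d V a b
  dist (inj₁ _) (inj₂ _) = D
  dist (inj₂ _) (inj₁ _) = D

  _⊏_ : P → P → Set
  inj₁ a ⊏ inj₁ b = _≺_ U a b
  inj₂ a ⊏ inj₂ b = _≺_ V a b
  inj₁ _ ⊏ inj₂ _ = ⊤
  inj₂ _ ⊏ inj₁ _ = ⊥

  private
    ≤D⊔D : ∀ {t} → t < D → t ≤ D ⊔ D
    ≤D⊔D t<D = ℚP.≤-trans (ℚP.<⇒≤ t<D) (ℚP.p≤p⊔q D D)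

  ultra : ∀ x y z → dist x z ≤ (dist x y ⊔ dist y z)
  ultra (inj₁ a) (inj₁ b) (inj₁ c) = d-ultra U a b c
  ultra (inj₂ a) (inj₂ b) (inj₂ c) = d-ultra V a b c
  ultra (inj₁ a) (inj₁ b) (inj₂ c) = ℚP.p≤q⊔p (d U a b) D
  ultra (inj₁ a) (inj₂ b) (inj₁ c) = ≤D⊔D (below-U a c)
  ultra (inj₁ a) (inj₂ b) (inj₂ c) = ℚP.p≤p⊔q D (d V b c)
  ultra (inj₂ a) (inj₁ b) (inj₁ c) = ℚP.p≤p⊔q D (d U b c)
  ultra (inj₂ a) (inj₁ b) (inj₂ c) = ≤D⊔D (below-V a c)
  ultra (inj₂ a) (inj₂ b) (inj₁ c) = ℚP.p≤q⊔p (d V a b) D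

  nonneg : ∀ x y → 0ℚ ≤ dist x y
  nonneg (inj₁ a) (inj₁ b) = d-nonneg U a b
  nonneg (inj₂ a) (inj₂ b) = d-nonneg V a b
  nonneg (inj₁ _) (inj₂ _) = ℚP.<⇒≤ D>0
  nonneg (inj₂ _) (inj₁ _) = ℚP.<⇒≤ D>0

  zero⇒≡ : ∀ x y → dist x y ≡ 0ℚ → x ≡ y
  zero⇒≡ (inj₁ a) (inj₁ b) e = cong inj₁ (d-zero⇒≡ U a b e)
  zero⇒≡ (inj₂ a) (inj₂ b) e = cong inj₂ (d-zero⇒≡ V a b e)
  zero⇒≡ (inj₁ _) (inj₂ _) e = ⊥-elim (ℚP.<-irrefl (sym e) D>0)
  zero⇒≡ (inj₂ _) (inj₁ _) e = ⊥-elim (ℚP.<-irrefl (sym e) D>0)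

  refl-0 : ∀ x → dist x x ≡ 0ℚ
  refl-0 (inj₁ a) = d-refl U a
  refl-0 (inj₂ a) = d-refl V a

  symmetric : ∀ x y → dist x y ≡ dist y x
  symmetric (inj₁ a) (inj₁ b) = d-sym U a b
  symmetric (inj₂ a) (inj₂ b) = d-sym V a b
  symmetric (inj₁ _) (inj₂ _) = refl
  symmetric (inj₂ _) (inj₁ _) = refl

  irreflexive : ∀ {x y} → x ≡ y → ¬ (x ⊏ y)
  irreflexive {inj₁ _} refl = SU.irrefl refl
  irreflexive {inj₂ _} refl = SV.irrefl refl

  transitive : ∀ {x y z} → x ⊏ y → y ⊏ z → x ⊏ z
  transitive {inj₁ _} {inj₁ _} {inj₁ _} p q = SU.trans p q
  transitive {inj₂ _} {inj₂ _} {inj₂ _} p q = SV.trans p q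
  transitive {inj₁ _} {inj₁ _} {inj₂ _} _ _ = tt
  transitive {inj₁ _} {inj₂ _} {inj₂ _} _ _ = tt
  transitive {inj₁ _} {inj₂ _} {inj₁ _} _ ()
  transitive {inj₂ _} {inj₁ _} ()
  transitive {inj₂ _} {inj₂ _} {inj₁ _} _ ()

  compare : ∀ x y → Tri (x ⊏ y) (x ≡ y) (y ⊏ x)
  compare (inj₁ a) (inj₁ b) with SU.compare a b
  ... | tri< lt ¬eq ¬gt = tri< lt (¬eq ∘ inj₁-injective) ¬gt
  ... | tri≈ ¬lt eq ¬gt = tri≈ ¬lt (cong inj₁ eq) ¬gt
  ... | tri> ¬lt ¬eq gt = tri> ¬lt (¬eq ∘ inj₁-injective) gt
  compare (inj₂ a) (inj₂ b) with SV.compare a b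
  ... | tri< lt ¬eq ¬gt = tri< lt (¬eq ∘ inj₂-injective) ¬gt
  ... | tri≈ ¬lt eq ¬gt = tri≈ ¬lt (cong inj₂ eq) ¬gt
  ... | tri> ¬lt ¬eq gt = tri> ¬lt (¬eq ∘ inj₂-injective) gt
  compare (inj₁ _) (inj₂ _) = tri< tt (λ ()) (λ ())
  compare (inj₂ _) (inj₁ _) = tri> (λ ()) (λ ()) tt

  -- convexity across the two parts holds because every distance inside U is below D
  convex-sum : ∀ x y z → x ⊏ y → y ⊏ z → dist x y ≤ dist x z
  convex-sum (inj₁ a) (inj₁ b) (inj₁ c) p q = convex U a b c p q
  convex-sum (inj₂ a) (inj₂ b) (inj₂ c) p q = convex V a b c p q
  convex-sum (inj₁ a) (inj₁ b) (inj₂ _) _ _ = ℚP.<⇒≤ (below-U a b)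
  convex-sum (inj₁ _) (inj₂ _) (inj₂ _) _ _ = ℚP.≤-refl
  convex-sum (inj₁ _) (inj₂ _) (inj₁ _) _ ()
  convex-sum (inj₂ _) (inj₁ _) _ ()
  convex-sum (inj₂ _) (inj₂ _) (inj₁ _) _ ()

  Sum : OrdUltrametric
  Sum = record
    { Carrier  = P
    ; d        = dist
    ; _≺_      = _⊏_
    ; d-nonneg = nonneg
    ; d-zero⇒≡ = zero⇒≡
    ; d-refl   = refl-0
    ; d-sym    = symmetric
    ; d-ultra  = ultra
    ; ≺-sto    = record
      { isStrictPartialOrder = record
        { isEquivalence = isEquivalence
        ; irrefl        = irreflexive
        ; trans         = λ {x} {y} {z} → transitive {x} {y} {z}
        ; <-resp-≈      = (λ { refl lt → lt }) , (λ { refl lt → lt }) }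
      ; compare = compare }
    ; convex   = convex-sum }

  left : Embedding U Sum
  left = record
    { emb = inj₁ ; injective = λ _ _ → inj₁-injective ; pres-d = λ _ _ → refl ; pres-≺ = λ _ _ → mk⇔ id id }

  sum-finite : IsFinite U → IsFinite V → IsFinite Sum
  sum-finite finU finV with finite⇒list U finU | finite⇒list V finV
  ... | xs , all-xs | ys , all-ys = list⇒finite Sum (map inj₁ xs ++ map inj₂ ys) enumerates
    where
    enumerates : ∀ x → x ∈ map inj₁ xs ++ map inj₂ ys
    enumerates (inj₁ a) = ∈-++⁺ˡ (∈-map⁺ inj₁ (all-xs a))
    enumerates (inj₂ b) = ∈-++⁺ʳ (map inj₁ xs) (∈-map⁺ inj₂ (all-ys b))

  lefts : List P → List (Carrier U)
  lefts []           = []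
  lefts (inj₁ a ∷ xs) = a ∷ lefts xs
  lefts (inj₂ _ ∷ xs) = lefts xs

  rights : List P → List (Carrier V)
  rights []           = []
  rights (inj₁ _ ∷ xs) = rights xs
  rights (inj₂ b ∷ xs) = b ∷ rights xs

  length-lefts+rights : ∀ xs → length xs ≡ length (lefts xs) ℕ.+ length (rights xs)
  length-lefts+rights []            = refl
  length-lefts+rights (inj₁ _ ∷ xs) = cong ℕ.suc (length-lefts+rights xs)
  length-lefts+rights (inj₂ _ ∷ xs) = trans (cong ℕ.suc (length-lefts+rights xs)) (sym (ℕP.+-suc _ _))

  module _ {r : ℚ} where
    private
      Edge : P → P → Set
      Edge x y = x ≢ y × dist x y ≡ r

      edges-left : ∀ {a xs} → All (Edge (inj₁ a)) xs → All (λ b → a ≢ b × d U a b ≡ r) (lefts xs)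
      edges-left {xs = []}          []                 = []
      edges-left {xs = inj₁ _ ∷ xs} ((a≢b , e) ∷ es)   = ((a≢b ∘ cong inj₁) , e) ∷ edges-left es
      edges-left {xs = inj₂ _ ∷ xs} (_ ∷ es)           = edges-left es

      edges-right : ∀ {a xs} → All (Edge (inj₂ a)) xs → All (λ b → a ≢ b × d V a b ≡ r) (rights xs)
      edges-right {xs = []}          []                = []
      edges-right {xs = inj₂ _ ∷ xs} ((a≢b , e) ∷ es)  = ((a≢b ∘ cong inj₂) , e) ∷ edges-right es
      edges-right {xs = inj₁ _ ∷ xs} (_ ∷ es)          = edges-right es

    lefts-polygon : ∀ {xs} → IsPolygon Sum r xs → IsPolygon U r (lefts xs)
    lefts-polygon {[]}          []         = []
    lefts-polygon {inj₁ _ ∷ xs} (es ∷ pol) = edges-left es ∷ lefts-polygon pol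
    lefts-polygon {inj₂ _ ∷ xs} (_ ∷ pol)  = lefts-polygon pol

    rights-polygon : ∀ {xs} → IsPolygon Sum r xs → IsPolygon V r (rights xs)
    rights-polygon {[]}          []         = []
    rights-polygon {inj₂ _ ∷ xs} (es ∷ pol) = edges-right es ∷ rights-polygon pol
    rights-polygon {inj₁ _ ∷ xs} (_ ∷ pol)  = rights-polygon pol

    -- if r ≢ D, the first point of an r-polygon is at distance r ≢ D from all others,
    -- so they lie on its side: the polygon lies entirely in U or entirely in V
    one-sided : r ≢ D → ∀ {xs} → IsPolygon Sum r xs → lefts xs ≡ [] ⊎ rights xs ≡ []
    one-sided r≢D {[]}          []      = inj₁ refl
    one-sided r≢D {inj₁ _ ∷ xs} (es ∷ _) = inj₂ (no-rights es)
      where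
      no-rights : ∀ {a ys} → All (Edge (inj₁ a)) ys → rights ys ≡ []
      no-rights {ys = []}          []             = refl
      no-rights {ys = inj₁ _ ∷ ys} (_ ∷ es)       = no-rights es
      no-rights {ys = inj₂ _ ∷ ys} ((_ , D≡r) ∷ _) = ⊥-elim (r≢D (sym D≡r))
    one-sided r≢D {inj₂ _ ∷ xs} (es ∷ _) = inj₁ (no-lefts es)
      where
      no-lefts : ∀ {a ys} → All (Edge (inj₂ a)) ys → lefts ys ≡ []
      no-lefts {ys = []}          []             = refl
      no-lefts {ys = inj₂ _ ∷ ys} (_ ∷ es)       = no-lefts es
      no-lefts {ys = inj₁ _ ∷ ys} ((_ , D≡r) ∷ _) = ⊥-elim (r≢D (sym D≡r))

  D-polygon-trivial : (A : OrdUltrametric) → (∀ a b → d A a b < D) →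
                      ∀ xs → IsPolygon A D xs → length xs ℕ.≤ 1
  D-polygon-trivial A below []          _                  = ℕ.z≤n
  D-polygon-trivial A below (_ ∷ [])    _                  = ℕ.s≤s ℕ.z≤n
  D-polygon-trivial A below (a ∷ b ∷ _) (((_ , e) ∷ _) ∷ _) = ⊥-elim (ℚP.<-irrefl e (below a b))

  -- The sum inherits polygon bounds N ≥ 2: a D-polygon has at most one point on each
  -- side, and any other polygon lies on one side.
  sum-polygonBounded : ∀ N → ValidBound N → PolygonBounded N U → PolygonBounded N V →
                       PolygonBounded N Sum
  sum-polygonBounded nothing  _   _        _        _ _  _   = tt
  sum-polygonBounded (just n) 2≤n boundedU boundedV r xs pol with r ℚP.≟ D
  ... | yes refl = begin
    length xs                                 ≡⟨ length-lefts+rights xs ⟩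
    length (lefts xs) ℕ.+ length (rights xs)  ≤⟨ ℕP.+-mono-≤ (D-polygon-trivial U below-U _ (lefts-polygon pol))
                                                               (D-polygon-trivial V below-V _ (rights-polygon pol)) ⟩
    2                                         ≤⟨ 2≤n ⟩
    n                                         ∎
    where open ℕP.≤-Reasoning
  ... | no r≢D with one-sided r≢D pol
  ...   | inj₁ no-lefts = begin
    length xs                                 ≡⟨ length-lefts+rights xs ⟩
    length (lefts xs) ℕ.+ length (rights xs)  ≡⟨ cong (λ ls → length ls ℕ.+ length (rights xs)) no-lefts ⟩
    length (rights xs)                        ≤⟨ boundedV r (rights xs) (rights-polygon pol) ⟩
    n                                         ∎
    where open ℕP.≤-Reasoning
  ...   | inj₂ no-rights = begin
    length xs                                 ≡⟨ length-lefts+rights xs ⟩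
    length (lefts xs) ℕ.+ length (rights xs)  ≡⟨ cong (λ rs → length (lefts xs) ℕ.+ length rs) no-rights ⟩
    length (lefts xs) ℕ.+ 0                   ≡⟨ ℕP.+-identityʳ _ ⟩
    length (lefts xs)                         ≤⟨ boundedU r (lefts xs) (lefts-polygon pol) ⟩
    n                                         ∎
    where open ℕP.≤-Reasoning

<1+ : ∀ p → p < 1ℚ + p
<1+ p = subst (_< 1ℚ + p) (ℚP.+-identityˡ p) (ℚP.+-monoˡ-< p (ℚP.positive⁻¹ 1ℚ))

<-⊓ : ∀ {t s D} → t < s → t < D → t < s ⊓ D
<-⊓ {t} {s} {D} t<s t<D with ℚP.⊓-sel s D
... | inj₁ s⊓D≡s = subst (t <_) (sym s⊓D≡s) t<s
... | inj₂ s⊓D≡D = subst (t <_) (sym s⊓D≡D) t<D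

distanceBound : (X : OrdUltrametric) (L : List (Carrier X)) →
                Σ ℚ λ D → 0ℚ < D × (∀ {x y} → x ∈ L → y ∈ L → d X x y < D)
distanceBound X L = 1ℚ + M , ℚP.≤-<-trans (ℚExtrema.⊥≤max 0ℚ ds) (<1+ M) , bounded
  where
  ds : List ℚ
  ds = cartesianProductWith (d X) L L
  M : ℚ
  M = ℚExtrema.max 0ℚ ds
  bounded : ∀ {x y} → x ∈ L → y ∈ L → d X x y < 1ℚ + M
  bounded x∈ y∈ = ℚP.≤-<-trans (All.lookup (ℚExtrema.xs≤max 0ℚ ds) (∈-cartesianProductWith⁺ (d X) x∈ y∈)) (<1+ M)

module _ (X : OrdUltrametric) where
  private
    C = Carrier X
    module SX = IsStrictTotalOrder (≺-sto X)

  -- Relations between points of X; a finite map is handled through its graph.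
  Dom Rng : (C → C → Set) → C → Set
  Dom R x = ∃ λ y → R x y
  Rng R y = ∃ λ x → R x y

  Functional Monotone Isometric : (C → C → Set) → Set
  Functional R = ∀ {a b b'} → R a b → R a b' → b ≡ b'
  Monotone   R = ∀ {a b a' b'} → R a b → R a' b' → _≺_ X a a' → _≺_ X b b'
  Isometric  R = ∀ {a b a' b'} → R a b → R a' b' → d X b b' ≡ d X a a'

  ImageIsBall : (Rg : C → Set) (R : C → C → Set) → C → ℚ → Set
  ImageIsBall Rg R x ρ = Σ C λ y → Rg y × Σ ℚ λ s → 0ℚ < s ×
    (∀ b → ((Rg b × d X y b < s) ⇔ (∃[ a ] (R a b × d X x a < ρ))))

  -- R maps balls around points of Dm onto balls of Rg: the shape of the fields
  -- balls→ and balls← of IsPartialBpAut.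
  BallsOnto : (Dm Rg : C → Set) (R : C → C → Set) → Set
  BallsOnto Dm Rg R = ∀ x → Dm x → ∀ ρ → 0ℚ < ρ → ImageIsBall Rg R x ρ

  BallProperty : (C → C → Set) → Set
  BallProperty R = BallsOnto (Dom R) (Rng R) R

  balls-transport : ∀ {Dm Rg R Dm' Rg' R'} → (∀ x → Dm' x → Dm x) → (∀ y → Rg y ⇔ Rg' y) →
                    (∀ a b → R a b ⇔ R' a b) → BallsOnto Dm Rg R → BallsOnto Dm' Rg' R'
  balls-transport dm rg rel balls x x∈ ρ ρ>0 with balls x (dm x x∈) ρ ρ>0
  ... | y , y∈ , s , s>0 , ball = y , to (rg y) y∈ , s , s>0 , λ b → mk⇔
    (λ { (b∈ , near) → let (a , rab , near') = to (ball b) (from (rg b) b∈ , near) in a , to (rel a b) rab , near' })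
    (λ { (a , rab , near) → let (b∈ , near') = from (ball b) (a , from (rel a b) rab , near) in to (rg b) b∈ , near' })
    where open Equivalence

  balls-resp : ∀ {R R'} → (∀ a b → R a b ⇔ R' a b) → BallProperty R → BallProperty R'
  balls-resp {R} {R'} rel = balls-transport (λ { x (y , r') → y , from (rel x y) r' })
    (λ y → mk⇔ (λ { (x , r) → x , to (rel x y) r }) (λ { (x , r') → x , from (rel x y) r' })) rel
    where open Equivalence

  isometric-functional : ∀ {R} → Isometric R → Functional R
  isometric-functional iso rab rab' = d-zero⇒≡ X _ _ (trans (iso rab rab') (d-refl X _))

  isometric-converse : ∀ {R} → Isometric R → Isometric (flip R)
  isometric-converse iso rba rb'a' = sym (iso rba rb'a')

  isometric-balls : ∀ {R} → Isometric R → BallProperty R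
  isometric-balls iso x (y , rxy) ρ ρ>0 = y , (x , rxy) , ρ , ρ>0 , λ b → mk⇔
    (λ { ((a , rab) , near) → a , rab , subst (_< ρ) (iso rxy rab) near })
    (λ { (a , rab , near) → (a , rab) , subst (_< ρ) (sym (iso rxy rab)) near })

  Graph Converse : PMap X → C → C → Set
  Graph    p a b = (a , b) ∈ p
  Converse p a b = (b , a) ∈ p

  ∈dom⇔ : ∀ {p x} → (x ∈ dom X p) ⇔ Dom (Graph p) x
  ∈dom⇔ = mk⇔ (λ m → case ∈-map⁻ proj₁ m of λ { ((_ , y) , m' , refl) → y , m' }) (λ (_ , m) → ∈-map⁺ proj₁ m)

  ∈rng⇔ : ∀ {p y} → (y ∈ rng X p) ⇔ Rng (Graph p) y
  ∈rng⇔ = mk⇔ (λ m → case ∈-map⁻ proj₂ m of λ { ((x , _) , m' , refl) → x , m' }) (λ (_ , m) → ∈-map⁺ proj₂ m)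

  graph-zdef : ∀ {p a b} → Graph p a b → a ∈ zdef X p × b ∈ zdef X p
  graph-zdef {p} m = ∈-++⁺ˡ (∈-map⁺ proj₁ m) , ∈-++⁺ʳ (dom X p) (∈-map⁺ proj₂ m)

  forward-balls : ∀ {p} → IsPartialBpAut X p → BallProperty (Graph p)
  forward-balls bp = balls-transport (λ _ → Equivalence.from ∈dom⇔) (λ _ → ∈rng⇔) (λ _ _ → ⇔-id _)
                                     (IsPartialBpAut.balls→ bp)

  backward-balls : ∀ {p} → IsPartialBpAut X p → BallProperty (Converse p)
  backward-balls bp = balls-transport (λ _ → Equivalence.from ∈rng⇔) (λ _ → ∈dom⇔) (λ _ _ → ⇔-id _)
                                      (IsPartialBpAut.balls← bp)

  mkPartialBpAut : ∀ {p} → Functional (Graph p) → Functional (Converse p) → Monotone (Graph p) →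
                   BallProperty (Graph p) → BallProperty (Converse p) → IsPartialBpAut X p
  mkPartialBpAut functional injective monotone balls balls' = record
    { functional = λ _ _ _ → functional
    ; injective  = λ _ _ _ → injective
    ; monotone   = λ _ _ _ _ → monotone
    ; balls→     = balls-transport (λ _ → Equivalence.to ∈dom⇔) (λ _ → ⇔-sym ∈rng⇔) (λ _ _ → ⇔-id _) balls
    ; balls←     = balls-transport (λ _ → Equivalence.to ∈rng⇔) (λ _ → ⇔-sym ∈dom⇔) (λ _ _ → ⇔-id _) balls' }

  graphOn : (C → C) → List C → PMap X
  graphOn h L = map (λ x → x , h x) L

  ∈graphOn : ∀ {h L a b} → (a , b) ∈ graphOn h L → a ∈ L × b ≡ h a
  ∈graphOn {h} m with ∈-map⁻ (λ x → x , h x) m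
  ... | _ , a∈ , refl = a∈ , refl

  graphOn-bp : ∀ h L → (∀ {a b} → a ∈ L → b ∈ L → d X (h a) (h b) ≡ d X a b) →
               (∀ {a b} → a ∈ L → b ∈ L → _≺_ X a b → _≺_ X (h a) (h b)) → IsPartialBpAut X (graphOn h L)
  graphOn-bp h L h-isometry h-monotone =
    mkPartialBpAut (isometric-functional iso) (isometric-functional (isometric-converse iso)) mono
                   (isometric-balls iso) (isometric-balls (isometric-converse iso))
    where
    iso : Isometric (Graph (graphOn h L))
    iso m m' with ∈graphOn m | ∈graphOn m'
    ... | a∈ , refl | a'∈ , refl = h-isometry a∈ a'∈
    mono : Monotone (Graph (graphOn h L))
    mono m m' with ∈graphOn m | ∈graphOn m'
    ... | a∈ , refl | a'∈ , refl = h-monotone a∈ a'∈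

  graphOn-embedding : ∀ h p r → (∀ {a b} → a ∈ zdef X p → b ∈ zdef X p → d X (h a) (h b) ≡ d X a b) →
                      (∀ {a b} → a ∈ zdef X p → b ∈ zdef X p → _≺_ X a b → _≺_ X (h a) (h b)) →
                      (∀ {a b} → (a , b) ∈ p → (h a , h b) ∈ r) →
                      IsEmbeddingInto X (graphOn h (zdef X p)) p r
  graphOn-embedding h p r h-isometry h-monotone carries = record
    { φ-bp    = graphOn-bp h (zdef X p) h-isometry h-monotone
    ; covers  = λ x x∈ → ∈-map⁺ proj₁ (∈-map⁺ (λ x → x , h x) x∈)
    ; commute = commute }
    where
    commute : ∀ x y u v → (x , y) ∈ p → (x , u) ∈ graphOn h (zdef X p) → (y , v) ∈ graphOn h (zdef X p) → (u , v) ∈ r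
    commute x y u v m mu mv with ∈graphOn mu | ∈graphOn mv
    ... | _ , refl | _ , refl = carries m

  record FarCopy (L₀ L₁ : List C) : Set where
    field
      ψ          : C → C
      D          : ℚ
      D>0        : 0ℚ < D
      near₀      : ∀ {u u'} → u ∈ L₀ → u' ∈ L₀ → d X u u' < D
      near₁      : ∀ {v v'} → v ∈ L₁ → v' ∈ L₁ → d X v v' < D
      far        : ∀ {u v} → u ∈ L₀ → v ∈ L₁ → d X u (ψ v) ≡ D
      ψ-isometry : ∀ {v v'} → v ∈ L₁ → v' ∈ L₁ → d X (ψ v) (ψ v') ≡ d X v v'
      ψ-monotone : ∀ {v v'} → v ∈ L₁ → v' ∈ L₁ → _≺_ X v v' → _≺_ X (ψ v) (ψ v')
      before     : ∀ {u v} → u ∈ L₀ → v ∈ L₁ → _≺_ X u (ψ v)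

    not-near : ∀ {u v} → u ∈ L₀ → v ∈ L₁ → ¬ (d X u (ψ v) < D)
    not-near u∈ v∈ = ℚP.<-irrefl (far u∈ v∈)

    not-near' : ∀ {u v} → u ∈ L₀ → v ∈ L₁ → ¬ (d X (ψ v) u < D)
    not-near' u∈ v∈ = ℚP.<-irrefl (trans (d-sym X _ _) (far u∈ v∈))

    separated : ∀ {u v} → u ∈ L₀ → v ∈ L₁ → u ≢ ψ v
    separated u∈ v∈ refl = not-near u∈ v∈ (subst (_< D) (sym (d-refl X _)) D>0)

    ψ-injective : ∀ {v v'} → v ∈ L₁ → v' ∈ L₁ → ψ v ≡ ψ v' → v ≡ v'
    ψ-injective v∈ v'∈ ψv≡ψv' =
      d-zero⇒≡ X _ _ (trans (sym (ψ-isometry v∈ v'∈)) (trans (cong (d X _) (sym ψv≡ψv')) (d-refl X _)))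

    -- ψ reflects the order on L₁, since it preserves it and the order is total
    ψ-reflects : ∀ {v v'} → v ∈ L₁ → v' ∈ L₁ → _≺_ X (ψ v) (ψ v') → _≺_ X v v'
    ψ-reflects {v} {v'} v∈ v'∈ lt with SX.compare v v'
    ... | tri< v<v' _ _ = v<v'
    ... | tri≈ _ refl _ = ⊥-elim (SX.irrefl refl lt)
    ... | tri> _ _ v'<v = ⊥-elim (SX.asym lt (ψ-monotone v'∈ v∈ v'<v))

  -- In a Fraïssé limit of K^≺_N with N ≥ 2, given any D above all distances inside L₀
  -- and inside L₁, the inclusion of L₀ extends by richness to the ordered sum L₀ ⊕_D L₁;
  -- its restriction to L₁ is a far copy of L₁ relative to L₀.
  farCopy-at : ∀ {N} → ValidBound N → IsFraisseLimit N X → (L₀ L₁ : List C) → (D : ℚ) → 0ℚ < D →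
               (∀ {u u'} → u ∈ L₀ → u' ∈ L₀ → d X u u' < D) →
               (∀ {v v'} → v ∈ L₁ → v' ∈ L₁ → d X v v' < D) → FarCopy L₀ L₁
  farCopy-at {N} N≥2 (_ , bounded , rich) L₀ L₁ D D>0 near₀ near₁ = record
    { ψ          = ψ
    ; D          = D
    ; D>0        = D>0
    ; near₀      = near₀
    ; near₁      = near₁
    ; far        = λ u∈ v∈ → trans (cong₂ (d X) (sym (g-left u∈)) (ψ-spec v∈)) (pres-d g (inj₁ _) (inj₂ _))
    ; ψ-isometry = λ v∈ v'∈ → trans (cong₂ (d X) (ψ-spec v∈) (ψ-spec v'∈)) (pres-d g (inj₂ _) (inj₂ _))
    ; ψ-monotone = λ v∈ v'∈ lt →
        subst₂ (_≺_ X) (sym (ψ-spec v∈)) (sym (ψ-spec v'∈)) (Equivalence.to (pres-≺ g (inj₂ _) (inj₂ _)) lt)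
    ; before     = λ u∈ v∈ →
        subst₂ (_≺_ X) (g-left u∈) (sym (ψ-spec v∈)) (Equivalence.to (pres-≺ g (inj₁ _) (inj₂ _)) tt) }
    where
    open DecMembership SX._≟_ using (_∈?_)
    module S₀ = ListSubspace X L₀
    module S₁ = ListSubspace X L₁
    module W = OrderedSum S₀.Sub S₁.Sub D D>0 (λ a b → near₀ (S₀.member-∈ a) (S₀.member-∈ b))
                                              (λ a b → near₁ (S₁.member-∈ a) (S₁.member-∈ b))

    extension : Σ (Embedding W.Sum X) λ g → ∀ a → emb g (emb W.left a) ≡ emb S₀.inclusion a
    extension = rich S₀.Sub W.Sum
      (S₀.sub-finite , S₀.sub-polygonBounded N bounded)
      (W.sum-finite S₀.sub-finite S₁.sub-finite ,
       W.sum-polygonBounded N N≥2 (S₀.sub-polygonBounded N bounded) (S₁.sub-polygonBounded N bounded))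
      W.left S₀.inclusion

    g : Embedding W.Sum X
    g = proj₁ extension

    g-left : ∀ {u} (u∈ : u ∈ L₀) → emb g (inj₁ (u # u∈)) ≡ u
    g-left u∈ = proj₂ extension (_ # u∈)

    ψ : C → C
    ψ v with v ∈? L₁
    ... | yes v∈ = emb g (inj₂ (v # v∈))
    ... | no _   = v

    ψ-spec : ∀ {v} (v∈ : v ∈ L₁) → ψ v ≡ emb g (inj₂ (v # v∈))
    ψ-spec {v} v∈ with v ∈? L₁
    ... | yes _  = refl
    ... | no v∉ = ⊥-elim (v∉ v∈)

  farCopy : ∀ {N} → ValidBound N → IsFraisseLimit N X → (L₀ L₁ : List C) → FarCopy L₀ L₁
  farCopy N≥2 limit L₀ L₁ with distanceBound X (L₀ ++ L₁)
  ... | D , D>0 , below = farCopy-at N≥2 limit L₀ L₁ D D>0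
    (λ u∈ u'∈ → below (∈-++⁺ˡ u∈) (∈-++⁺ˡ u'∈)) (λ v∈ v'∈ → below (∈-++⁺ʳ L₀ v∈) (∈-++⁺ʳ L₀ v'∈))

  module Union {L₀ L₁ : List C} (fc : FarCopy L₀ L₁) where
    open FarCopy fc

    _∪ψ_ : (C → C → Set) → (C → C → Set) → C → C → Set
    (R₀ ∪ψ R₁) a b = R₀ a b ⊎ ∃ λ a' → ∃ λ b' → R₁ a' b' × a ≡ ψ a' × b ≡ ψ b'

    ∪ψ-flip : ∀ {R₀ R₁ a b} → (R₀ ∪ψ R₁) b a → (flip R₀ ∪ψ flip R₁) a b
    ∪ψ-flip (inj₁ r)                       = inj₁ r
    ∪ψ-flip (inj₂ (b' , a' , r , b≡ , a≡)) = inj₂ (a' , b' , r , a≡ , b≡)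

    Placed : C → Set
    Placed z = z ∈ L₀ ⊎ ∃ λ v → v ∈ L₁ × z ≡ ψ v

    placed-close : ∀ {z z'} → Placed z → Placed z' → d X z z' ≤ D
    placed-close (inj₁ u∈) (inj₁ u'∈) = ℚP.<⇒≤ (near₀ u∈ u'∈)
    placed-close (inj₁ u∈) (inj₂ (_ , v∈ , refl)) = ℚP.≤-reflexive (far u∈ v∈)
    placed-close (inj₂ (_ , v∈ , refl)) (inj₁ u∈) = ℚP.≤-reflexive (trans (d-sym X _ _) (far u∈ v∈))
    placed-close (inj₂ (_ , v∈ , refl)) (inj₂ (_ , v'∈ , refl)) =
      ℚP.≤-trans (ℚP.≤-reflexive (ψ-isometry v∈ v'∈)) (ℚP.<⇒≤ (near₁ v∈ v'∈))

    module gluing (R₀ R₁ : C → C → Set)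
             (inside₀ : ∀ {a b} → R₀ a b → a ∈ L₀ × b ∈ L₀)
             (inside₁ : ∀ {a b} → R₁ a b → a ∈ L₁ × b ∈ L₁) where
      private
        R : C → C → Set
        R = R₀ ∪ψ R₁

      placed : ∀ {a b} → R a b → Placed a × Placed b
      placed (inj₁ r) = inj₁ (proj₁ (inside₀ r)) , inj₁ (proj₂ (inside₀ r))
      placed (inj₂ (a , b , r , refl , refl)) = inj₂ (a , proj₁ (inside₁ r) , refl) , inj₂ (b , proj₂ (inside₁ r) , refl)

      -- the two parts have disjoint domains, since L₀ and ψ[L₁] are disjoint
      union-functional : Functional R₀ → Functional R₁ → Functional R
      union-functional f₀ f₁ (inj₁ r) (inj₁ r') = f₀ r r'
      union-functional f₀ f₁ (inj₁ r) (inj₂ (_ , _ , r' , a≡ψa' , _)) =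
        ⊥-elim (separated (proj₁ (inside₀ r)) (proj₁ (inside₁ r')) a≡ψa')
      union-functional f₀ f₁ (inj₂ (_ , _ , r , a≡ψa' , _)) (inj₁ r') =
        ⊥-elim (separated (proj₁ (inside₀ r')) (proj₁ (inside₁ r)) a≡ψa')
      union-functional f₀ f₁ (inj₂ (a , _ , r , refl , refl)) (inj₂ (a' , _ , r' , ψa≡ψa' , refl))
        with ψ-injective (proj₁ (inside₁ r)) (proj₁ (inside₁ r')) ψa≡ψa'
      ... | refl = cong ψ (f₁ r r')

      -- L₀ lies before ψ[L₁], and ψ preserves and reflects the order on L₁
      union-monotone : Monotone R₀ → Monotone R₁ → Monotone R
      union-monotone m₀ m₁ (inj₁ r) (inj₁ r') lt = m₀ r r' lt
      union-monotone m₀ m₁ (inj₁ r) (inj₂ (_ , _ , r' , refl , refl)) _ =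
        before (proj₂ (inside₀ r)) (proj₂ (inside₁ r'))
      union-monotone m₀ m₁ (inj₂ (_ , _ , r , refl , refl)) (inj₁ r') lt =
        ⊥-elim (SX.asym lt (before (proj₁ (inside₀ r')) (proj₁ (inside₁ r))))
      union-monotone m₀ m₁ (inj₂ (_ , _ , r , refl , refl)) (inj₂ (_ , _ , r' , refl , refl)) lt =
        ψ-monotone (proj₂ (inside₁ r)) (proj₂ (inside₁ r'))
                   (m₁ r r' (ψ-reflects (proj₁ (inside₁ r)) (proj₁ (inside₁ r')) lt))

      -- A ball of radius ρ > D around a placed point contains every placed point, so its
      -- image is the whole range: the ball of radius 1 + D around any point of the range.
      whole-ball : ∀ {x y ρ} → Placed x → R x y → D < ρ → ImageIsBall (Rng R) R x ρ
      whole-ball {x} {y} x-placed rxy D<ρ = y , (x , rxy) , 1ℚ + D , ℚP.<-trans D>0 (<1+ D) , λ b → mk⇔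
        (λ { ((a , rab) , _) → a , rab , ℚP.≤-<-trans (placed-close x-placed (proj₁ (placed rab))) D<ρ })
        (λ { (a , rab , _) → (a , rab) , ℚP.≤-<-trans (placed-close (proj₂ (placed rxy)) (proj₂ (placed rab))) (<1+ D) })

      -- A ball of radius ρ ≤ D around a point of L₀ meets no point of the copy; its image
      -- is its R₀-image, a ball whose radius may be shrunk to s ⊓ D to avoid the copy too.
      left-ball : BallProperty R₀ → ∀ {x x' ρ} → R₀ x x' → 0ℚ < ρ → ρ ≤ D → ImageIsBall (Rng R) R x ρ
      left-ball balls₀ {x} {x'} {ρ} r₀ ρ>0 ρ≤D with balls₀ x (x' , r₀) ρ ρ>0
      ... | y , (a₀ , ra₀y) , s , s>0 , ball =
        y , (a₀ , inj₁ ra₀y) , s ⊓ D , <-⊓ s>0 D>0 , λ b → mk⇔ (forth b) (back b)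
        where
        y∈ : y ∈ L₀
        y∈ = proj₂ (inside₀ ra₀y)
        forth : ∀ b → Rng R b × d X y b < s ⊓ D → ∃[ a ] (R a b × d X x a < ρ)
        forth b ((a , inj₁ rab) , near) with Equivalence.to (ball b) ((a , rab) , ℚP.<-≤-trans near (ℚP.p⊓q≤p s D))
        ... | a' , ra'b , near' = a' , inj₁ ra'b , near'
        forth _ ((_ , inj₂ (_ , _ , r₁ , refl , refl)) , near) =
          ⊥-elim (not-near y∈ (proj₂ (inside₁ r₁)) (ℚP.<-≤-trans near (ℚP.p⊓q≤q s D)))
        back : ∀ b → ∃[ a ] (R a b × d X x a < ρ) → Rng R b × d X y b < s ⊓ D
        back b (a , inj₁ rab , near) with Equivalence.from (ball b) (a , rab , near)
        ... | (a' , ra'b) , near' = (a' , inj₁ ra'b) , <-⊓ near' (near₀ y∈ (proj₂ (inside₀ ra'b)))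
        back _ (_ , inj₂ (_ , _ , r₁ , refl , refl) , near) =
          ⊥-elim (not-near (proj₁ (inside₀ r₀)) (proj₁ (inside₁ r₁)) (ℚP.<-≤-trans near ρ≤D))

      -- Symmetrically, a ball of radius ρ ≤ D around a point ψ x of the copy is the ψ-image
      -- of a ball around x, and its image is the ψ-image of the R₁-image of that ball.
      right-ball : BallProperty R₁ → ∀ {x x' ρ} → R₁ x x' → 0ℚ < ρ → ρ ≤ D → ImageIsBall (Rng R) R (ψ x) ρ
      right-ball balls₁ {x} {x'} {ρ} r₁ ρ>0 ρ≤D with balls₁ x (x' , r₁) ρ ρ>0
      ... | y , (a₀ , ra₀y) , s , s>0 , ball =
        ψ y , (ψ a₀ , inj₂ (a₀ , y , ra₀y , refl , refl)) , s ⊓ D , <-⊓ s>0 D>0 , λ b → mk⇔ (forth b) (back b)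
        where
        x∈ : x ∈ L₁
        x∈ = proj₁ (inside₁ r₁)
        y∈ : y ∈ L₁
        y∈ = proj₂ (inside₁ ra₀y)
        forth : ∀ b → Rng R b × d X (ψ y) b < s ⊓ D → ∃[ a ] (R a b × d X (ψ x) a < ρ)
        forth _ ((_ , inj₁ rab) , near) =
          ⊥-elim (not-near' (proj₂ (inside₀ rab)) y∈ (ℚP.<-≤-trans near (ℚP.p⊓q≤q s D)))
        forth _ ((_ , inj₂ (a , b , rab , refl , refl)) , near)
          with Equivalence.to (ball b)
                 ((a , rab) , ℚP.<-≤-trans (subst (_< s ⊓ D) (ψ-isometry y∈ (proj₂ (inside₁ rab))) near) (ℚP.p⊓q≤p s D))
        ... | a' , ra'b , near' =
          ψ a' , inj₂ (a' , b , ra'b , refl , refl) , subst (_< ρ) (sym (ψ-isometry x∈ (proj₁ (inside₁ ra'b)))) near'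
        back : ∀ b → ∃[ a ] (R a b × d X (ψ x) a < ρ) → Rng R b × d X (ψ y) b < s ⊓ D
        back _ (_ , inj₁ rab , near) = ⊥-elim (not-near' (proj₁ (inside₀ rab)) x∈ (ℚP.<-≤-trans near ρ≤D))
        back _ (_ , inj₂ (a , b , rab , refl , refl) , near)
          with Equivalence.from (ball b) (a , rab , subst (_< ρ) (ψ-isometry x∈ (proj₁ (inside₁ rab))) near)
        ... | (a' , ra'b) , near' =
          (ψ a' , inj₂ (a' , b , ra'b , refl , refl)) ,
          subst (_< s ⊓ D) (sym (ψ-isometry y∈ (proj₂ (inside₁ rab)))) (<-⊓ near' (near₁ y∈ (proj₂ (inside₁ rab))))

      union-balls : BallProperty R₀ → BallProperty R₁ → BallProperty R
      union-balls balls₀ _ x (_ , inj₁ r₀) ρ ρ>0 with ρ ℚP.≤? D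
      ... | yes ρ≤D = left-ball balls₀ r₀ ρ>0 ρ≤D
      ... | no ρ≰D  = whole-ball (inj₁ (proj₁ (inside₀ r₀))) (inj₁ r₀) (ℚP.≰⇒> ρ≰D)
      union-balls _ balls₁ _ (_ , inj₂ (x , x' , r₁ , refl , refl)) ρ ρ>0 with ρ ℚP.≤? D
      ... | yes ρ≤D = right-ball balls₁ r₁ ρ>0 ρ≤D
      ... | no ρ≰D  = whole-ball (inj₂ (x , proj₁ (inside₁ r₁) , refl)) (inj₂ (x , x' , r₁ , refl , refl)) (ℚP.≰⇒> ρ≰D)

  module Amalgam (q₀ q₁ : PMap X) (bp₀ : IsPartialBpAut X q₀) (bp₁ : IsPartialBpAut X q₁)
                 (fc : FarCopy (zdef X q₀) (zdef X q₁)) where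
    open FarCopy fc
    open Union fc

    shift : C × C → C × C
    shift (a , b) = ψ a , ψ b

    amalgam : PMap X
    amalgam = q₀ ++ map shift q₁

    ∈amalgam⇔ : ∀ {a b} → Graph amalgam a b ⇔ (Graph q₀ ∪ψ Graph q₁) a b
    ∈amalgam⇔ = mk⇔ split join
      where
      split : ∀ {a b} → (a , b) ∈ amalgam → (Graph q₀ ∪ψ Graph q₁) a b
      split m with ∈-++⁻ q₀ m
      ... | inj₁ m₀ = inj₁ m₀
      ... | inj₂ m₁ with ∈-map⁻ shift m₁
      ...   | (a , b) , m , refl = inj₂ (a , b , m , refl , refl)
      join : ∀ {a b} → (Graph q₀ ∪ψ Graph q₁) a b → (a , b) ∈ amalgam
      join (inj₁ m₀) = ∈-++⁺ˡ m₀
      join (inj₂ (_ , _ , m₁ , refl , refl)) = ∈-++⁺ʳ q₀ (∈-map⁺ shift m₁)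

    ∈amalgam⇔′ : ∀ {a b} → Converse amalgam a b ⇔ (Converse q₀ ∪ψ Converse q₁) a b
    ∈amalgam⇔′ = mk⇔ (∪ψ-flip {Graph q₀} {Graph q₁} ∘ Equivalence.to ∈amalgam⇔)
                     (Equivalence.from ∈amalgam⇔ ∘ ∪ψ-flip {Converse q₀} {Converse q₁})

    amalgam-bp : IsPartialBpAut X amalgam
    amalgam-bp = mkPartialBpAut
      (λ m m' → forward.union-functional (IsPartialBpAut.functional bp₀ _ _ _) (IsPartialBpAut.functional bp₁ _ _ _)
                                         (to ∈amalgam⇔ m) (to ∈amalgam⇔ m'))
      (λ m m' → backward.union-functional (IsPartialBpAut.injective bp₀ _ _ _) (IsPartialBpAut.injective bp₁ _ _ _)
                                          (to ∈amalgam⇔′ m) (to ∈amalgam⇔′ m'))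
      (λ m m' → forward.union-monotone (IsPartialBpAut.monotone bp₀ _ _ _ _) (IsPartialBpAut.monotone bp₁ _ _ _ _)
                                       (to ∈amalgam⇔ m) (to ∈amalgam⇔ m'))
      (balls-resp (λ _ _ → ⇔-sym ∈amalgam⇔) (forward.union-balls (forward-balls bp₀) (forward-balls bp₁)))
      (balls-resp (λ _ _ → ⇔-sym ∈amalgam⇔′) (backward.union-balls (backward-balls bp₀) (backward-balls bp₁)))
      where
      open Equivalence
      module forward  = Union.gluing fc (Graph q₀) (Graph q₁) graph-zdef graph-zdef
      module backward = Union.gluing fc (Converse q₀) (Converse q₁) (swap ∘ graph-zdef) (swap ∘ graph-zdef)

    φ₀ φ₁ : PMap X
    φ₀ = graphOn id (zdef X q₀)
    φ₁ = graphOn ψ (zdef X q₁)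

    embedding₀ : IsEmbeddingInto X φ₀ q₀ amalgam
    embedding₀ = graphOn-embedding id q₀ amalgam (λ _ _ → refl) (λ _ _ lt → lt) ∈-++⁺ˡ

    embedding₁ : IsEmbeddingInto X φ₁ q₁ amalgam
    embedding₁ = graphOn-embedding ψ q₁ amalgam ψ-isometry ψ-monotone (λ m → ∈-++⁺ʳ q₀ (∈-map⁺ shift m))

    -- φ₀ fixes zdef q₀ while φ₁ moves zdef q₁ into the far copy, which avoids zdef q₀
    images-disjoint : ∀ v → ¬ (InImage X φ₀ (zdef X q₀) v × InImage X φ₁ (zdef X q₁) v)
    images-disjoint _ ((u , u∈ , m₀) , (w , w∈ , m₁)) =
      separated u∈ w∈ (trans (sym (proj₂ (∈graphOn m₀))) (proj₂ (∈graphOn m₁)))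

proposition5p4 : (N : Bound) → ValidBound N → (X : OrdUltrametric) → IsFraisseLimit N X →
    (q₀ q₁ : PMap X) → IsPartialBpAut X q₀ → IsPartialBpAut X q₁ →
    Σ (PMap X) λ r → IsPartialBpAut X r ×
      Σ (PMap X) λ φ₀ → Σ (PMap X) λ φ₁ →
        IsEmbeddingInto X φ₀ q₀ r × IsEmbeddingInto X φ₁ q₁ r ×
        (∀ v → ¬ (InImage X φ₀ (zdef X q₀) v × InImage X φ₁ (zdef X q₁) v))
proposition5p4 N N≥2 X limit q₀ q₁ bp₀ bp₁ =
  amalgam , amalgam-bp , φ₀ , φ₁ , embedding₀ , embedding₁ , images-disjoint
  where
  open Amalgam X q₀ q₁ bp₀ bp₁ (farCopy X N≥2 limit (zdef X q₀) (zdef X q₁))
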